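{- Let $f:2^{\mathcal{N}}\to\mathbb{Z}_{\ge0}$ be a polymatroid with $f(\{e\})>0$ for every $e\in\mathcal{N}$, $r=f(\mathcal{N})\ge2$ and $k^*:=k^*(f)\ge120\log^2 r$. Let $e_1,\dots,e_n$ be an ordering of $\mathcal{N}$ and $\mathcal{N}_{\mathsf{good}}$ the set of good elements. Then for every closed set $A\subseteq\mathcal{N}$, $$\sum_{e\in\mathcal{N}_{\mathsf{good}}\setminus A}\big(f(A\cup\{e\})-f(A)\big)\ge\frac{k^*}{2}\big(f(\mathcal{N})-f(A)\big).$$
   Context: A polymatroid is an integer-valued, monotone, submodular set function with value $0$ on the empty set. For a polymatroid $g$ on ground set $\mathcal{M}$, $k^*(g):=\min_{A\subseteq\mathcal{M}:\, g(A)<g(\mathcal{M})}\left\lfloor\frac{\sum_{e\in\mathcal{M}}(g(A\cup\{e\})-g(A))}{g(\mathcal{M})-g(A)}\right\rfloor$. $\mathrm{span}(S)=\{e: f(S\cup\{e\})=f(S)\}$; $S$ is closed if $\mathrm{span}(S)=S$. A set $Q\subseteq\mathcal{V}$ is a quotient of a polymatroid $h$ on $\mathcal{V}$ if $h((\mathcal{V}\setminus Q)\cup\{e\})>h(\mathcal{V}\setminus Q)$ for all $e\in Q$. With $\mathcal{N}_t=\{e_1,\dots,e_t\}$, $q_t=\min\{|Q|: e_t\in Q\subseteq\mathcal{N}_t,\ Q\text{ a quotient of }f_{|\mathcal{N}_t}\}$ where $f_{|\mathcal{N}_t}$ is the restriction. Element $e_t$ is good if $\frac{k^*}{2r}<q_t<2rk^*$;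 $\mathcal{N}_{\mathsf{good}}$ is the set of good elements. Logarithms are base 2. -}

module Defs where

open import Data.Nat using (ℕ; zero; suc; _+_; _*_; _∸_; _^_; _≤_; _<_; _≤?_)
open import Data.Nat.Base using (>-nonZero)
open import Data.Nat.DivMod using (_/_)
open import Data.Nat.Properties using (m<n⇒0<n∸m)
open import Data.Bool using (Bool; if_then_else_)
open import Data.Fin using (Fin; toℕ)
open import Data.Fin.Subset using (Subset; ⊥; ⊤; ⁅_⁆; _∈_; _∉_; _⊆_; _∪_; _∩_; _─_; ∣_∣)
open import Data.List using (List; map; allFin)
open import Data.Nat.ListAction using (sum)
open import Data.Vec using (lookup; tabulate)
open import Data.Product using (Σ; _×_; ∃)
open import Function.Bundles using (_↔_; Inverse)
open import Relation.Binary.PropositionalEquality using (_≡_)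
open import Relation.Nullary.Decidable using (⌊_⌋)

SetFn : ℕ → Set
SetFn n = Subset n → ℕ

record IsPolymatroid {n : ℕ} (f : SetFn n) : Set where
  field
    empty0     : f ⊥ ≡ 0
    monotone   : ∀ A B → A ⊆ B → f A ≤ f B
    submodular : ∀ A B → f (A ∪ B) + f (A ∩ B) ≤ f A + f B

Σall : {n : ℕ} → (Fin n → ℕ) → ℕ
Σall {n} g = sum (map g (allFin n))

-- marginal value f(A ∪ {e}) - f(A)   (nonnegative for monotone f)
marg : {n : ℕ} → SetFn n → Subset n → Fin n → ℕ
marg f A e = f (A ∪ ⁅ e ⁆) ∸ f A

ΣmargOver : {n : ℕ} → SetFn n → Subset n → Subset n → ℕ
ΣmargOver f S A = Σall (λ e → if lookup S e then marg f A e else 0)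

kval : {n : ℕ} → (g : SetFn n) → (A : Subset n) → g A < g ⊤ → ℕ
kval g A p = _/_ (Σall (marg g A)) (g ⊤ ∸ g A) {{>-nonZero (m<n⇒0<n∸m p)}}

IsKStar : {n : ℕ} → SetFn n → ℕ → Set
IsKStar g k =
  (Σ (Subset _) λ A → Σ (g A < g ⊤) λ p → kval g A p ≡ k)
  × (∀ A → (p : g A < g ⊤) → k ≤ kval g A p)

_∈span_ : {n : ℕ} {f : SetFn n} → Fin n → Subset n → Set
_∈span_ {f = f} e S = f (S ∪ ⁅ e ⁆) ≡ f S

IsClosed : {n : ℕ} → SetFn n → Subset n → Set
IsClosed f S = ∀ e → (_∈span_ {f = f} e S → e ∈ S) × (e ∈ S → _∈span_ {f = f} e S)

-- Ordering e_1,…,e_n of the ground set: a bijection σ : Fin n ↔ Fin n,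
-- e_{j+1} = to σ j (0-indexed j).  Prefix N_{j+1} = { to σ i : i ≤ j }.
Prefix : {n : ℕ} → (Fin n ↔ Fin n) → Fin n → Subset n
Prefix σ j = tabulate (λ x → ⌊ toℕ (Inverse.from σ x) ≤? toℕ j ⌋)

IsQuotient : {n : ℕ} → SetFn n → Subset n → Subset n → Set
IsQuotient h V Q = Q ⊆ V × (∀ e → e ∈ Q → h (V ─ Q) < h ((V ─ Q) ∪ ⁅ e ⁆))

-- q is q_t for t = j+1: minimum |Q| over quotients Q of f|N_t containing e_t
IsQ : {n : ℕ} → SetFn n → (Fin n ↔ Fin n) → Fin n → ℕ → Set
IsQ f σ j q =
  (Σ (Subset _) λ Q → Inverse.to σ j ∈ Q × IsQuotient f (Prefix σ j) Q × ∣ Q ∣ ≡ q)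
  × (∀ Q → Inverse.to σ j ∈ Q → IsQuotient f (Prefix σ j) Q → q ≤ ∣ Q ∣)

IsGood : {n : ℕ} → SetFn n → (Fin n ↔ Fin n) → ℕ → ℕ → Fin n → Set
IsGood f σ r k j = ∃ λ q → IsQ f σ j q × (k < 2 * r * q) × (q < 2 * r * k)

-- k ≥ 120 (log₂ r)², stated without reals: for every rational p/q < log₂ r
-- (i.e. 2^p < r^q) we have 120 (p/q)² ≤ k.  Equivalent by density of ℚ.
LogSqBound : ℕ → ℕ → Set
LogSqBound k r = ∀ p q → 0 < q → 2 ^ p < r ^ q → 120 * (p * p) ≤ k * (q * q)

{-# OPTIONS --safe #-}
module Submission where

-- Let r′ = r − f(A) and K = k*·r′.  Cut the ordering at a prefix 𝒩_m with at most K elements outside A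
-- whose marginals over A still sum to at least K: marginals outside the closed set A are ≥ 1, and if
-- no prefix has exactly K such elements then |𝒩 ∖ A| < K and the definition of k* supplies the bound.
-- For e_t ∈ 𝒩_m ∖ A the set 𝒩_t ∖ A is a quotient of f|𝒩_t (A is closed and f submodular), so
-- q_t ≤ K < 2rk* and e_t is good unless q_t ≤ θ := ⌊k*/2r⌋.  These bad elements number at most θ·r,
-- since walking along the ordering each of them lowers the rank of a test set by one at the price of
-- at most θ elements of its quotient.  Each marginal is at most r′, so the bad elements carry at most
-- θ·r·r′ ≤ K/2 of the marginal mass, and the good ones the rest.

open import Defs
open import Algebra.Properties.CommutativeSemigroup using (x∙yz≈y∙xz)
open import Data.Bool using (if_then_else_)
open import Data.Bool.Properties using (T-≡)
open import Data.Empty using (⊥-elim)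
open import Data.Fin using (Fin; zero; suc; toℕ; fromℕ<)
open import Data.Fin.Properties using (all?; toℕ<n; toℕ-fromℕ<; toℕ-injective)
open import Data.Fin.Subset
  using (Subset; inside; outside; ⊤; ⊥; ⁅_⁆; _∈_; _∉_; _⊆_; _⊂_; _∪_; _∩_; _─_; ∣_∣)
open import Data.Fin.Subset.Properties
  using ( _∈?_; _⊆?_; anySubset?; drop-∷-⊆; ⊆⊤; p⊆q⇒∣p∣≤∣q∣; p⊂q⇒∣p∣<∣q∣; ∣p∣≤∣x∷p∣; ∣⊥∣≡0; ∣⁅x⁆∣≡1
        ; x∈⁅x⁆; x∈⁅y⁆⇒x≡y; p⊆p∪q; q⊆p∪q; x∈p∪q⁺; x∈p∪q⁻; p∩q⊆q; x∈p∩q⁺; x∈p∩q⁻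
        ; x∈p∧x∉q⇒x∈p─q; p─q⊆p; p─⊤≡⊥ )
open import Data.List.Properties using (map-tabulate)
open import Data.Nat using (ℕ; zero; suc; _+_; _*_; _∸_; _≤_; _<_; z≤n; s≤s; _≤?_; _<?_; _≟_; NonZero; >-nonZero)
open import Data.Nat.DivMod using (_/_; m/n*n≤m; m*n/n≡m; /-monoˡ-≤)
open import Data.Nat.ListAction using (sum)
open import Data.Nat.Properties
open import Data.Nat.Tactic.RingSolver using (solve-∀)
open import Data.Product using (∃; _×_; _,_; proj₁; proj₂)
open import Data.Sum using (_⊎_; inj₁; inj₂)
import Data.Sum as Sum
open import Data.Vec using (_∷_; []; lookup; here; there)
import Data.Vec as Vec
open import Data.Vec.Properties using (lookup∘tabulate; []=⇒lookup; lookup⇒[]=)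
open import Function using (_∘_)
open import Function.Bundles using (_↔_; Inverse; Equivalence)
open import Level using (0ℓ)
open import Relation.Binary.PropositionalEquality
open import Relation.Nullary using (yes; no; contradiction)
open import Relation.Nullary.Decidable using (⌊_⌋; toWitness; fromWitness; _×-dec_; _→-dec_)
open import Relation.Unary using (Pred; Decidable)

private
  variable
    n : ℕ
    p q : Subset n
    x : Fin n

discrete-intermediate-value : (c : ℕ → ℕ) → c 0 ≡ 0 → ∀ N → (∀ m → m < N → c (suc m) ≤ suc (c m)) →
                              ∀ K → c N < K ⊎ ∃ λ m → c m ≡ K
discrete-intermediate-value c c0≡0 zero    _    zero    = inj₂ (0 , c0≡0)
discrete-intermediate-value c c0≡0 zero    _    (suc K) = inj₁ (≤-trans (≤-reflexive (cong suc c0≡0)) (s≤s z≤n))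
discrete-intermediate-value c c0≡0 (suc N) step K
  with discrete-intermediate-value c c0≡0 N (λ m m<N → step m (m<n⇒m<1+n m<N)) K
... | inj₂ hit = inj₂ hit
... | inj₁ cN<K with c (suc N) ≟ K
...   | yes hit = inj₂ (suc N , hit)
...   | no  miss = inj₁ (≤∧≢⇒< (≤-trans (step N ≤-refl) cN<K) miss)

m≤n+o∧2o≤m⇒m≤2n : ∀ {m n o} → m ≤ n + o → 2 * o ≤ m → m ≤ 2 * n
m≤n+o∧2o≤m⇒m≤2n {m} {n} {o} m≤n+o 2o≤m = +-cancelʳ-≤ m m (2 * n) (begin
  m + m                ≤⟨ +-mono-≤ m≤n+o m≤n+o ⟩
  (n + o) + (n + o)    ≡⟨ double-sum n o ⟩
  2 * n + 2 * o        ≤⟨ +-monoʳ-≤ (2 * n) 2o≤m ⟩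
  2 * n + m            ∎)
  where
  open ≤-Reasoning
  double-sum : ∀ a b → (a + b) + (a + b) ≡ 2 * a + 2 * b
  double-sum = solve-∀

x∈p─q⇒x∉q : ∀ (p q : Subset n) → x ∈ p ─ q → x ∉ q
x∈p─q⇒x∉q (s ∷ p) (outside ∷ q) here        ()
x∈p─q⇒x∉q (s ∷ p) (t ∷ q)       (there x∈) (there x∈q) = x∈p─q⇒x∉q p q x∈ x∈q

∣p∪q∣≤∣p∣+∣q∣ : ∀ (p q : Subset n) → ∣ p ∪ q ∣ ≤ ∣ p ∣ + ∣ q ∣
∣p∪q∣≤∣p∣+∣q∣ []            []            = z≤n
∣p∪q∣≤∣p∣+∣q∣ (inside ∷ p)  (t ∷ q)       = s≤s (≤-trans (∣p∪q∣≤∣p∣+∣q∣ p q) (+-monoʳ-≤ ∣ p ∣ (∣p∣≤∣x∷p∣ t q)))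
∣p∪q∣≤∣p∣+∣q∣ (outside ∷ p) (inside ∷ q)  = ≤-trans (s≤s (∣p∪q∣≤∣p∣+∣q∣ p q)) (≤-reflexive (sym (+-suc ∣ p ∣ ∣ q ∣)))
∣p∪q∣≤∣p∣+∣q∣ (outside ∷ p) (outside ∷ q) = ∣p∪q∣≤∣p∣+∣q∣ p q

module _ {P : Pred (Fin n) 0ℓ} (P? : Decidable P) where

  ∈tabulate⁺ : P x → x ∈ Vec.tabulate (λ y → ⌊ P? y ⌋)
  ∈tabulate⁺ {x} px = lookup⇒[]= x _ (trans (lookup∘tabulate _ x) (Equivalence.to T-≡ (fromWitness px)))

  ∈tabulate⁻ : x ∈ Vec.tabulate (λ y → ⌊ P? y ⌋) → P x
  ∈tabulate⁻ {x} x∈ = toWitness (Equivalence.from T-≡ (trans (sym (lookup∘tabulate _ x)) ([]=⇒lookup x∈)))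

∣∣-step : ∀ {p q : Subset n} {x} → (∀ {y} → y ∈ p → y ∈ q ⊎ y ≡ x) → ∣ p ∣ ≤ suc ∣ q ∣
∣∣-step {p = p} {q} {x} p⊆q+x = begin
  ∣ p ∣               ≤⟨ p⊆q⇒∣p∣≤∣q∣ (x∈p∪q⁺ ∘ Sum.map₂ (λ { refl → x∈⁅x⁆ x }) ∘ p⊆q+x) ⟩
  ∣ q ∪ ⁅ x ⁆ ∣       ≤⟨ ∣p∪q∣≤∣p∣+∣q∣ q ⁅ x ⁆ ⟩
  ∣ q ∣ + ∣ ⁅ x ⁆ ∣   ≡⟨ cong (∣ q ∣ +_) (∣⁅x⁆∣≡1 x) ⟩
  ∣ q ∣ + 1           ≡⟨ +-comm ∣ q ∣ 1 ⟩
  suc ∣ q ∣           ∎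
  where open ≤-Reasoning

minimal-witness : {P : Pred (Subset n) 0ℓ} → Decidable P → ∀ {Q} → P Q →
                  ∃ λ Q′ → P Q′ × (∀ {Q″} → P Q″ → ∣ Q′ ∣ ≤ ∣ Q″ ∣)
minimal-witness {P = P} P? {Q} PQ = go ∣ Q ∣ PQ ≤-refl
  where
  go : ∀ s {Q} → P Q → ∣ Q ∣ ≤ s → ∃ λ Q′ → P Q′ × (∀ {Q″} → P Q″ → ∣ Q′ ∣ ≤ ∣ Q″ ∣)
  go zero    {Q} PQ ∣Q∣≤0 = Q , PQ , λ _ → ≤-trans ∣Q∣≤0 z≤n
  go (suc s) {Q} PQ ∣Q∣≤s with anySubset? (λ Q′ → P? Q′ ×-dec ∣ Q′ ∣ <? ∣ Q ∣)
  ... | yes (Q′ , PQ′ , smaller) = go s PQ′ (m<1+n⇒m≤n (<-≤-trans smaller ∣Q∣≤s))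
  ... | no  none                 = Q , PQ , λ PQ″ → ≮⇒≥ (λ smaller → none (_ , PQ″ , smaller))

ΣOver : Subset n → (Fin n → ℕ) → ℕ
ΣOver []      g = 0
ΣOver (s ∷ p) g = (if s then g zero else 0) + ΣOver p (g ∘ suc)

Σall-suc : (g : Fin (suc n) → ℕ) → Σall g ≡ g zero + Σall (g ∘ suc)
Σall-suc {n} g = cong (λ xs → g zero + sum xs)
  (trans (map-tabulate suc g) (sym (map-tabulate (λ i → i) (g ∘ suc))))

Σall-if≡ΣOver : (p : Subset n) (g : Fin n → ℕ) →
                Σall (λ x → if lookup p x then g x else 0) ≡ ΣOver p g
Σall-if≡ΣOver []      g = refl
Σall-if≡ΣOver (s ∷ p) g =
  trans (Σall-suc (λ x → if lookup (s ∷ p) x then g x else 0)) (cong (_ +_) (Σall-if≡ΣOver p (g ∘ suc)))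

Σall≡ΣOver⊤ : (g : Fin n → ℕ) → Σall g ≡ ΣOver ⊤ g
Σall≡ΣOver⊤ {zero}  g = refl
Σall≡ΣOver⊤ {suc n} g = trans (Σall-suc g) (cong (g zero +_) (Σall≡ΣOver⊤ (g ∘ suc)))

ΣOver-mono-⊆ : (g : Fin n → ℕ) → p ⊆ q → ΣOver p g ≤ ΣOver q g
ΣOver-mono-⊆ {p = []}          {[]}          g p⊆q = z≤n
ΣOver-mono-⊆ {p = inside ∷ p}  {inside ∷ q}  g p⊆q = +-monoʳ-≤ (g zero) (ΣOver-mono-⊆ (g ∘ suc) (drop-∷-⊆ p⊆q))
ΣOver-mono-⊆ {p = inside ∷ p}  {outside ∷ q} g p⊆q with () ← p⊆q here
ΣOver-mono-⊆ {p = outside ∷ p} {t ∷ q}       g p⊆q =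
  ≤-trans (ΣOver-mono-⊆ (g ∘ suc) (drop-∷-⊆ p⊆q)) (m≤n+m _ _)

ΣOver-∪ : (g : Fin n → ℕ) (p q : Subset n) → ΣOver (p ∪ q) g ≤ ΣOver p g + ΣOver q g
ΣOver-∪ g []            []      = z≤n
ΣOver-∪ g (inside ∷ p)  (t ∷ q) = begin
  g zero + ΣOver (p ∪ q) g′                 ≤⟨ +-monoʳ-≤ (g zero) (ΣOver-∪ g′ p q) ⟩
  g zero + (ΣOver p g′ + ΣOver q g′)        ≡⟨ +-assoc (g zero) _ _ ⟨
  g zero + ΣOver p g′ + ΣOver q g′          ≤⟨ +-monoʳ-≤ (g zero + ΣOver p g′) (m≤n+m (ΣOver q g′) _) ⟩
  g zero + ΣOver p g′ + ΣOver (t ∷ q) g     ∎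
  where
  open ≤-Reasoning
  g′ : Fin _ → ℕ
  g′ = g ∘ suc
ΣOver-∪ g (outside ∷ p) (t ∷ q) = begin
  h + ΣOver (p ∪ q) g′                      ≤⟨ +-monoʳ-≤ h (ΣOver-∪ g′ p q) ⟩
  h + (ΣOver p g′ + ΣOver q g′)             ≡⟨ x∙yz≈y∙xz +-commutativeSemigroup h (ΣOver p g′) (ΣOver q g′) ⟩
  ΣOver p g′ + (h + ΣOver q g′)             ∎
  where
  open ≤-Reasoning
  g′ : Fin _ → ℕ
  g′ = g ∘ suc
  h : ℕ
  h = if t then g zero else 0

ΣOver-≥ : ∀ {a} (g : Fin n → ℕ) (p : Subset n) → (∀ {x} → x ∈ p → a ≤ g x) → ∣ p ∣ * a ≤ ΣOver p g
ΣOver-≥ g []            a≤g = z≤n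
ΣOver-≥ g (inside ∷ p)  a≤g = +-mono-≤ (a≤g here) (ΣOver-≥ (g ∘ suc) p (a≤g ∘ there))
ΣOver-≥ g (outside ∷ p) a≤g = ΣOver-≥ (g ∘ suc) p (a≤g ∘ there)

ΣOver-≤ : ∀ {b} (g : Fin n → ℕ) (p : Subset n) → (∀ {x} → x ∈ p → g x ≤ b) → ΣOver p g ≤ ∣ p ∣ * b
ΣOver-≤ g []            g≤b = z≤n
ΣOver-≤ g (inside ∷ p)  g≤b = +-mono-≤ (g≤b here) (ΣOver-≤ (g ∘ suc) p (g≤b ∘ there))
ΣOver-≤ g (outside ∷ p) g≤b = ΣOver-≤ (g ∘ suc) p (g≤b ∘ there)

module Ordering (σ : Fin n ↔ Fin n) where
  open Inverse σ using (to; from; strictlyInverseˡ; strictlyInverseʳ)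

  position : Fin n → ℕ
  position x = toℕ (from x)

  -- Initial m is the paper's 𝒩_m = {e_1, …, e_m}, whereas Prefix σ j of Defs is 𝒩_{j+1}.
  Initial : ℕ → Subset n
  Initial m = Vec.tabulate (λ x → ⌊ position x <? m ⌋)

  ∈Initial⁺ : ∀ {m} → position x < m → x ∈ Initial m
  ∈Initial⁺ {m = m} = ∈tabulate⁺ (λ y → position y <? m)

  ∈Initial⁻ : ∀ {m} → x ∈ Initial m → position x < m
  ∈Initial⁻ {m = m} = ∈tabulate⁻ (λ y → position y <? m)

  ∈Prefix⁺ : ∀ {j} → position x ≤ toℕ j → x ∈ Prefix σ j
  ∈Prefix⁺ {j = j} = ∈tabulate⁺ (λ y → position y ≤? toℕ j)

  ∈Prefix⁻ : ∀ {j} → x ∈ Prefix σ j → position x ≤ toℕ j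
  ∈Prefix⁻ {j = j} = ∈tabulate⁻ (λ y → position y ≤? toℕ j)

  ∉Initial0 : x ∉ Initial 0
  ∉Initial0 x∈ with () ← ∈Initial⁻ {m = 0} x∈

  ⊆Initial0⇒∣∣≡0 : ∀ {p} → p ⊆ Initial 0 → ∣ p ∣ ≡ 0
  ⊆Initial0⇒∣∣≡0 p⊆I0 = n≤0⇒n≡0 (≤-trans (p⊆q⇒∣p∣≤∣q∣ {q = ⊥} (⊥-elim ∘ ∉Initial0 ∘ p⊆I0)) (≤-reflexive (∣⊥∣≡0 n)))

  ∈Initial-all : x ∈ Initial n
  ∈Initial-all {x} = ∈Initial⁺ (toℕ<n (from x))

  Initial-mono : ∀ {m m′} → m ≤ m′ → Initial m ⊆ Initial m′
  Initial-mono m≤m′ x∈ = ∈Initial⁺ (<-≤-trans (∈Initial⁻ x∈) m≤m′)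

  Initial─⊆Initial-suc─ : ∀ m p → Initial m ─ p ⊆ Initial (suc m) ─ p
  Initial─⊆Initial-suc─ m p x∈ = x∈p∧x∉q⇒x∈p─q (Initial-mono (n≤1+n m) (p─q⊆p _ p x∈)) (x∈p─q⇒x∉q _ p x∈)

  Prefix⊆Initial : ∀ {j m} → toℕ j < m → Prefix σ j ⊆ Initial m
  Prefix⊆Initial j<m x∈ = ∈Initial⁺ (≤-<-trans (∈Prefix⁻ x∈) j<m)

  Initial⊆Prefix : ∀ {j m} → m ≤ toℕ j → Initial m ⊆ Prefix σ j
  Initial⊆Prefix m≤j x∈ = ∈Prefix⁺ (<⇒≤ (<-≤-trans (∈Initial⁻ x∈) m≤j))

  position-to : ∀ j → position (to j) ≡ toℕ j
  position-to j = cong toℕ (strictlyInverseʳ j)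

  module _ {m} (m<n : m < n) where

    next : Fin n
    next = to (fromℕ< m<n)

    position-next : position next ≡ m
    position-next = trans (position-to (fromℕ< m<n)) (toℕ-fromℕ< m<n)

    next∉Initial : next ∉ Initial m
    next∉Initial next∈ = <-irrefl position-next (∈Initial⁻ next∈)

    next∈Initial : next ∈ Initial (suc m)
    next∈Initial = ∈Initial⁺ (s≤s (≤-reflexive position-next))

    Initial-suc : x ∈ Initial (suc m) → x ∈ Initial m ⊎ x ≡ next
    Initial-suc {x} x∈ with m<1+n⇒m<n∨m≡n (∈Initial⁻ x∈)
    ... | inj₁ x<m = inj₁ (∈Initial⁺ x<m)
    ... | inj₂ x≡m = inj₂ (begin
      x                   ≡⟨ strictlyInverseˡ x ⟨
      to (from x)         ≡⟨ cong to (toℕ-injective (trans x≡m (sym (toℕ-fromℕ< m<n)))) ⟩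
      next                ∎)
      where open ≡-Reasoning

    ∣p∩Initial-suc∣≤ : ∀ p → ∣ p ∩ Initial (suc m) ∣ ≤ suc ∣ p ∩ Initial m ∣
    ∣p∩Initial-suc∣≤ p = ∣∣-step λ y∈ → let y∈p , y∈I = x∈p∩q⁻ p _ y∈ in
      Sum.map₁ (λ y∈I′ → x∈p∩q⁺ (y∈p , y∈I′)) (Initial-suc y∈I)

    ∣Initial-suc─p∣≤ : ∀ p → ∣ Initial (suc m) ─ p ∣ ≤ suc ∣ Initial m ─ p ∣
    ∣Initial-suc─p∣≤ p = ∣∣-step λ y∈ →
      Sum.map₁ (λ y∈I → x∈p∧x∉q⇒x∈p─q y∈I (x∈p─q⇒x∉q _ p y∈)) (Initial-suc (p─q⊆p _ p y∈))

module PolymatroidProperties {f : SetFn n} (isPolymatroid : IsPolymatroid f) where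
  open IsPolymatroid isPolymatroid

  mono : p ⊆ q → f p ≤ f q
  mono = monotone _ _

  ∩-rank-drop : ∀ {C Y : Subset n} {e} → f C < f (C ∪ ⁅ e ⁆) → e ∈ Y → f (Y ∩ C) < f Y
  ∩-rank-drop {C} {Y} {e} C<C+e e∈Y = +-cancelʳ-< (f C) (f (Y ∩ C)) (f Y) (begin-strict
    f (Y ∩ C) + f C          <⟨ +-monoʳ-< (f (Y ∩ C)) (<-≤-trans C<C+e (mono C+e⊆Y∪C)) ⟩
    f (Y ∩ C) + f (Y ∪ C)    ≡⟨ +-comm (f (Y ∩ C)) (f (Y ∪ C)) ⟩
    f (Y ∪ C) + f (Y ∩ C)    ≤⟨ submodular Y C ⟩
    f Y + f C                ∎)
    where
    open ≤-Reasoning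
    C+e⊆Y∪C : C ∪ ⁅ e ⁆ ⊆ Y ∪ C
    C+e⊆Y∪C x∈ with x∈p∪q⁻ C ⁅ e ⁆ x∈
    ... | inj₁ x∈C  = q⊆p∪q Y C x∈C
    ... | inj₂ x∈e  = p⊆p∪q C (subst (_∈ Y) (sym (x∈⁅y⁆⇒x≡y e x∈e)) e∈Y)

  marginal-antitone : ∀ {W A : Subset n} {x} → W ⊆ A → f A < f (A ∪ ⁅ x ⁆) → f W < f (W ∪ ⁅ x ⁆)
  marginal-antitone {W} {A} {x} W⊆A A<A+x =
    ≤-<-trans (mono W⊆[W+x]∩A) (∩-rank-drop A<A+x (q⊆p∪q W ⁅ x ⁆ (x∈⁅x⁆ x)))
    where
    W⊆[W+x]∩A : W ⊆ (W ∪ ⁅ x ⁆) ∩ A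
    W⊆[W+x]∩A y∈W = x∈p∩q⁺ (p⊆p∪q ⁅ x ⁆ y∈W , W⊆A y∈W)

  module _ {A : Subset n} (closed : IsClosed f A) where

    closed⇒marginal>0 : x ∉ A → f A < f (A ∪ ⁅ x ⁆)
    closed⇒marginal>0 {x} x∉A = ≤∧≢⇒< (mono (p⊆p∪q ⁅ x ⁆)) (λ eq → x∉A (proj₁ (closed x) (sym eq)))

    closed⇒marg≡0 : x ∈ A → marg f A x ≡ 0
    closed⇒marg≡0 {x} x∈A = trans (cong (_∸ f A) (proj₂ (closed x) x∈A)) (n∸n≡0 (f A))

    closed⇒quotient : ∀ V → IsQuotient f V (V ─ A)
    closed⇒quotient V = p─q⊆p V A , λ e e∈ →
      marginal-antitone V─[V─A]⊆A (closed⇒marginal>0 (x∈p─q⇒x∉q V A e∈))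
      where
      V─[V─A]⊆A : V ─ (V ─ A) ⊆ A
      V─[V─A]⊆A {y} y∈ with y ∈? A
      ... | yes y∈A = y∈A
      ... | no  y∉A = contradiction (x∈p∧x∉q⇒x∈p─q (p─q⊆p V _ y∈) y∉A) (x∈p─q⇒x∉q V (V ─ A) y∈)

  marg≤gap : ∀ A x → marg f A x ≤ f ⊤ ∸ f A
  marg≤gap A x = ∸-monoˡ-≤ (f A) (mono ⊆⊤)

isQuotient? : (h : SetFn n) (V : Subset n) → Decidable (IsQuotient h V)
isQuotient? h V Q = (Q ⊆? V) ×-dec all? (λ e → (e ∈? Q) →-dec (h (V ─ Q) <? h ((V ─ Q) ∪ ⁅ e ⁆)))

IsQ-exists : ∀ (f : SetFn n) σ j {Q} → Inverse.to σ j ∈ Q → IsQuotient f (Prefix σ j) Q →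
             ∃ λ q → IsQ f σ j q × q ≤ ∣ Q ∣
IsQ-exists f σ j e∈Q Q-quot
  with minimal-witness (λ Q → (Inverse.to σ j ∈? Q) ×-dec isQuotient? f (Prefix σ j) Q) (e∈Q , Q-quot)
... | Q′ , (e∈Q′ , Q′-quot) , minimal =
  ∣ Q′ ∣ , ((Q′ , e∈Q′ , Q′-quot , refl) , λ _ e∈Q″ Q″-quot → minimal (e∈Q″ , Q″-quot)) , minimal (e∈Q , Q-quot)

module _ {f : SetFn n} (isPolymatroid : IsPolymatroid f) (σ : Fin n ↔ Fin n) where
  open Inverse σ using (to)
  open Ordering σ
  open PolymatroidProperties isPolymatroid

  HasQuotientOfSize≤ : ℕ → Fin n → Set
  HasQuotientOfSize≤ θ j = ∃ λ Q → to j ∈ Q × IsQuotient f (Prefix σ j) Q × ∣ Q ∣ ≤ θ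

  module _ (θ : ℕ) {B : Subset n} (small : ∀ j → to j ∈ B → HasQuotientOfSize≤ θ j) where

    open ≤-Reasoning

    -- An element e ∈ B ∩ Y with small quotient Q is paid for by shrinking the test set Y to
    -- Y ∩ (𝒩_e ∖ Q), which has smaller rank, while the ≤ θ elements of Q re-enter the count.
    ∣B∩Initial-suc∣≤ : ∀ {m} (m<n : m < n) → (∀ Y → ∣ B ∩ Initial m ∣ ≤ θ * f Y + ∣ Initial m ─ Y ∣) →
                       ∀ Y → ∣ B ∩ Initial (suc m) ∣ ≤ θ * f Y + ∣ Initial (suc m) ─ Y ∣
    ∣B∩Initial-suc∣≤ {m} m<n IH Y with next m<n ∈? B | next m<n ∈? Y
    ... | no e∉B | _ = begin
      ∣ B ∩ Initial (suc m) ∣             ≤⟨ p⊆q⇒∣p∣≤∣q∣ B∩I′⊆B∩I ⟩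
      ∣ B ∩ Initial m ∣                   ≤⟨ IH Y ⟩
      θ * f Y + ∣ Initial m ─ Y ∣         ≤⟨ +-monoʳ-≤ (θ * f Y) (p⊆q⇒∣p∣≤∣q∣ (Initial─⊆Initial-suc─ m Y)) ⟩
      θ * f Y + ∣ Initial (suc m) ─ Y ∣   ∎
      where
      B∩I′⊆B∩I : B ∩ Initial (suc m) ⊆ B ∩ Initial m
      B∩I′⊆B∩I x∈ with x∈p∩q⁻ B _ x∈
      ... | x∈B , x∈I′ with Initial-suc m<n x∈I′
      ...   | inj₁ x∈I = x∈p∩q⁺ (x∈B , x∈I)
      ...   | inj₂ refl = contradiction x∈B e∉B
    ... | yes e∈B | no e∉Y = begin
      ∣ B ∩ Initial (suc m) ∣             ≤⟨ ∣p∩Initial-suc∣≤ m<n B ⟩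
      suc ∣ B ∩ Initial m ∣               ≤⟨ s≤s (IH Y) ⟩
      suc (θ * f Y + ∣ Initial m ─ Y ∣)   ≡⟨ +-suc (θ * f Y) _ ⟨
      θ * f Y + suc ∣ Initial m ─ Y ∣     ≤⟨ +-monoʳ-≤ (θ * f Y) (p⊂q⇒∣p∣<∣q∣ I─Y⊂I′─Y) ⟩
      θ * f Y + ∣ Initial (suc m) ─ Y ∣   ∎
      where
      I─Y⊂I′─Y : Initial m ─ Y ⊂ Initial (suc m) ─ Y
      I─Y⊂I′─Y = Initial─⊆Initial-suc─ m Y , next m<n ,
                 x∈p∧x∉q⇒x∈p─q (next∈Initial m<n) e∉Y , next∉Initial m<n ∘ p─q⊆p _ Y
    ... | yes e∈B | yes e∈Y with small (fromℕ< m<n) e∈B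
    ...   | Q , e∈Q , (_ , Q-quot) , ∣Q∣≤θ = begin
      ∣ B ∩ Initial (suc m) ∣                      ≤⟨ ∣p∩Initial-suc∣≤ m<n B ⟩
      suc ∣ B ∩ Initial m ∣                        ≤⟨ s≤s (IH (Y ∩ C)) ⟩
      suc (θ * f (Y ∩ C) + ∣ Initial m ─ Y ∩ C ∣)  ≡⟨ +-suc (θ * f (Y ∩ C)) _ ⟨
      θ * f (Y ∩ C) + suc ∣ Initial m ─ Y ∩ C ∣    ≤⟨ +-monoʳ-≤ (θ * f (Y ∩ C)) growth ⟩
      θ * f (Y ∩ C) + (R + ∣ Q ∣)                  ≤⟨ +-monoʳ-≤ (θ * f (Y ∩ C)) (+-monoʳ-≤ R ∣Q∣≤θ) ⟩
      θ * f (Y ∩ C) + (R + θ)                      ≡⟨ rearrange θ (f (Y ∩ C)) R ⟩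
      θ * suc (f (Y ∩ C)) + R                      ≤⟨ +-monoˡ-≤ R (*-monoʳ-≤ θ (∩-rank-drop (Q-quot _ e∈Q) e∈Y)) ⟩
      θ * f Y + R                                  ∎
      where
      C : Subset n
      C = Prefix σ (fromℕ< m<n) ─ Q
      R : ℕ
      R = ∣ Initial (suc m) ─ Y ∣
      rearrange : ∀ a b c → a * b + (c + a) ≡ a * suc b + c
      rearrange = solve-∀
      I─Y∩C⊆I′─Y∪Q : Initial m ─ Y ∩ C ⊆ (Initial (suc m) ─ Y) ∪ Q
      I─Y∩C⊆I′─Y∪Q {x} x∈ with x ∈? Y | x ∈? Q
      ... | no x∉Y  | _       = p⊆p∪q Q (x∈p∧x∉q⇒x∈p─q (Initial-mono (n≤1+n m) (p─q⊆p _ _ x∈)) x∉Y)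
      ... | yes _   | yes x∈Q = q⊆p∪q _ Q x∈Q
      ... | yes x∈Y | no x∉Q  = contradiction (x∈p∩q⁺ (x∈Y , x∈p∧x∉q⇒x∈p─q x∈V x∉Q)) (x∈p─q⇒x∉q _ _ x∈)
        where
        x∈V : x ∈ Prefix σ (fromℕ< m<n)
        x∈V = Initial⊆Prefix (≤-reflexive (sym (toℕ-fromℕ< m<n))) (p─q⊆p _ _ x∈)
      growth : suc ∣ Initial m ─ Y ∩ C ∣ ≤ R + ∣ Q ∣
      growth = ≤-trans (p⊂q⇒∣p∣<∣q∣ (I─Y∩C⊆I′─Y∪Q , next m<n , q⊆p∪q _ Q e∈Q , next∉Initial m<n ∘ p─q⊆p _ _))
                       (∣p∪q∣≤∣p∣+∣q∣ (Initial (suc m) ─ Y) Q)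

    ∣B∩Initial∣≤ : ∀ m → m ≤ n → ∀ Y → ∣ B ∩ Initial m ∣ ≤ θ * f Y + ∣ Initial m ─ Y ∣
    ∣B∩Initial∣≤ zero    _   Y = ≤-trans (≤-reflexive (⊆Initial0⇒∣∣≡0 (p∩q⊆q B _))) z≤n
    ∣B∩Initial∣≤ (suc m) m<n = ∣B∩Initial-suc∣≤ m<n (∣B∩Initial∣≤ m (<⇒≤ m<n))

    ∣B∣≤θr : ∣ B ∣ ≤ θ * f ⊤
    ∣B∣≤θr = begin
      ∣ B ∣                          ≤⟨ p⊆q⇒∣p∣≤∣q∣ {p = B} (λ x∈B → x∈p∩q⁺ (x∈B , ∈Initial-all)) ⟩
      ∣ B ∩ Initial n ∣              ≤⟨ ∣B∩Initial∣≤ n ≤-refl ⊤ ⟩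
      θ * f ⊤ + ∣ Initial n ─ ⊤ ∣    ≡⟨ cong (λ S → θ * f ⊤ + ∣ S ∣) (p─⊤≡⊥ (Initial n)) ⟩
      θ * f ⊤ + ∣ ⊥ {n} ∣            ≡⟨ cong (θ * f ⊤ +_) (∣⊥∣≡0 n) ⟩
      θ * f ⊤ + 0                    ≡⟨ +-identityʳ (θ * f ⊤) ⟩
      θ * f ⊤                        ∎

module _ {f : SetFn n} (isPolymatroid : IsPolymatroid f) (σ : Fin n ↔ Fin n)
         {k : ℕ} (0<k : 0 < k) (k≤kval : ∀ A (A<⊤ : f A < f ⊤) → k ≤ kval f A A<⊤)
         {G : Subset n} (good⊆G : ∀ j → IsGood f σ (f ⊤) k j → Inverse.to σ j ∈ G)
         {A : Subset n} (closed : IsClosed f A) (A<⊤ : f A < f ⊤) where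
  open Inverse σ using (to)
  open Ordering σ
  open PolymatroidProperties isPolymatroid
  open ≤-Reasoning

  gap : ℕ
  gap = f ⊤ ∸ f A

  K : ℕ
  K = k * gap

  0<r : 0 < f ⊤
  0<r = ≤-<-trans z≤n A<⊤

  private instance
    gap-nonZero : NonZero gap
    gap-nonZero = >-nonZero (m<n⇒0<n∸m A<⊤)
    r-nonZero : NonZero (f ⊤)
    r-nonZero = >-nonZero 0<r
    2r-nonZero : NonZero (2 * f ⊤)
    2r-nonZero = m*n≢0 2 (f ⊤)

  θ : ℕ
  θ = k / (2 * f ⊤)

  K≤Σmarg : K ≤ Σall (marg f A)
  K≤Σmarg = ≤-trans (*-monoˡ-≤ gap (k≤kval A A<⊤)) (m/n*n≤m (Σall (marg f A)) gap)

  K<2rk : K < 2 * f ⊤ * k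
  K<2rk = begin-strict
    k * gap               ≤⟨ *-monoʳ-≤ k (m∸n≤m (f ⊤) (f A)) ⟩
    k * f ⊤               <⟨ m<m+n (k * f ⊤) (*-mono-≤ 0<k 0<r) ⟩
    k * f ⊤ + k * f ⊤     ≡⟨ double k (f ⊤) ⟩
    2 * f ⊤ * k           ∎
    where
    double : ∀ a b → a * b + a * b ≡ 2 * b * a
    double = solve-∀

  q≤θ : ∀ {q} → 2 * f ⊤ * q ≤ k → q ≤ θ
  q≤θ {q} 2rq≤k = begin
    q                            ≡⟨ m*n/n≡m q (2 * f ⊤) ⟨
    q * (2 * f ⊤) / (2 * f ⊤)    ≤⟨ /-monoˡ-≤ (2 * f ⊤) (≤-trans (≤-reflexive (*-comm q (2 * f ⊤))) 2rq≤k) ⟩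
    θ                            ∎

  2rθ≤k : 2 * f ⊤ * θ ≤ k
  2rθ≤k = ≤-trans (≤-reflexive (*-comm (2 * f ⊤) θ)) (m/n*n≤m k (2 * f ⊤))

  short-prefix-with-large-marginals : ∃ λ m → ∣ Initial m ─ A ∣ ≤ K × K ≤ ΣOver (Initial m ─ A) (marg f A)
  short-prefix-with-large-marginals
    with discrete-intermediate-value (λ m → ∣ Initial m ─ A ∣) (⊆Initial0⇒∣∣≡0 (p─q⊆p _ A)) n
           (λ m m<n → ∣Initial-suc─p∣≤ m<n A) K
  ... | inj₁ ∣I─A∣<K = n , <⇒≤ ∣I─A∣<K , (begin
    K                                                ≤⟨ K≤Σmarg ⟩
    Σall (marg f A)                                  ≡⟨ Σall≡ΣOver⊤ (marg f A) ⟩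
    ΣOver ⊤ (marg f A)                               ≤⟨ ΣOver-mono-⊆ (marg f A) ⊤⊆I─A∪A ⟩
    ΣOver ((Initial n ─ A) ∪ A) (marg f A)           ≤⟨ ΣOver-∪ (marg f A) (Initial n ─ A) A ⟩
    ΣOver (Initial n ─ A) (marg f A) + ΣOver A (marg f A)
                                                     ≤⟨ +-monoʳ-≤ _ (ΣOver-≤ (marg f A) A (≤-reflexive ∘ closed⇒marg≡0 closed)) ⟩
    ΣOver (Initial n ─ A) (marg f A) + ∣ A ∣ * 0     ≡⟨ cong (ΣOver (Initial n ─ A) (marg f A) +_) (*-zeroʳ ∣ A ∣) ⟩
    ΣOver (Initial n ─ A) (marg f A) + 0             ≡⟨ +-identityʳ _ ⟩
    ΣOver (Initial n ─ A) (marg f A)                 ∎)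
    where
    ⊤⊆I─A∪A : ⊤ ⊆ (Initial n ─ A) ∪ A
    ⊤⊆I─A∪A {x} _ with x ∈? A
    ... | yes x∈A = q⊆p∪q _ A x∈A
    ... | no  x∉A = p⊆p∪q A (x∈p∧x∉q⇒x∈p─q ∈Initial-all x∉A)
  ... | inj₂ (m , ∣I─A∣≡K) = m , ≤-reflexive ∣I─A∣≡K , (begin
    K                                   ≡⟨ ∣I─A∣≡K ⟨
    ∣ Initial m ─ A ∣                   ≡⟨ *-identityʳ _ ⟨
    ∣ Initial m ─ A ∣ * 1               ≤⟨ ΣOver-≥ (marg f A) (Initial m ─ A) (λ x∈ →
                                             m<n⇒0<n∸m (closed⇒marginal>0 closed (x∈p─q⇒x∉q _ A x∈))) ⟩
    ΣOver (Initial m ─ A) (marg f A)    ∎)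

  minimal-quotient-in-prefix : ∀ {m} j → to j ∈ Initial m ─ A → ∃ λ q → IsQ f σ j q × q ≤ ∣ Initial m ─ A ∣
  minimal-quotient-in-prefix {m} j e∈I─A =
    let q , isQ , q≤∣V─A∣ = IsQ-exists f σ j e∈V─A (closed⇒quotient closed V)
    in  q , isQ , ≤-trans q≤∣V─A∣ (p⊆q⇒∣p∣≤∣q∣ V─A⊆I─A)
    where
    V : Subset n
    V = Prefix σ j
    e∈V─A : to j ∈ V ─ A
    e∈V─A = x∈p∧x∉q⇒x∈p─q (∈Prefix⁺ (≤-reflexive (position-to j))) (x∈p─q⇒x∉q _ A e∈I─A)
    j<m : toℕ j < m
    j<m = subst (_< m) (position-to j) (∈Initial⁻ (p─q⊆p _ A e∈I─A))
    V─A⊆I─A : V ─ A ⊆ Initial m ─ A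
    V─A⊆I─A x∈ = x∈p∧x∉q⇒x∈p─q (Prefix⊆Initial j<m (p─q⊆p V A x∈)) (x∈p─q⇒x∉q V A x∈)

  good-or-small : ∀ {m} → ∣ Initial m ─ A ∣ ≤ K →
                  ∀ j → to j ∈ Initial m ─ A → to j ∈ G ⊎ HasQuotientOfSize≤ isPolymatroid σ θ j
  good-or-small {m} ∣I─A∣≤K j e∈I─A with minimal-quotient-in-prefix j e∈I─A
  ... | q , isQ@((Q , e∈Q , Q-quot , ∣Q∣≡q) , _) , q≤∣I─A∣ with k <? 2 * f ⊤ * q
  ...   | yes k<2rq = inj₁ (good⊆G j (q , isQ , k<2rq , ≤-<-trans (≤-trans q≤∣I─A∣ ∣I─A∣≤K) K<2rk))
  ...   | no  k≮2rq = inj₂ (Q , e∈Q , Q-quot , ≤-trans (≤-reflexive ∣Q∣≡q) (q≤θ (≮⇒≥ k≮2rq)))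

  K≤2ΣOver-good : ∀ {m} → ∣ Initial m ─ A ∣ ≤ K → K ≤ ΣOver (Initial m ─ A) (marg f A) →
                  K ≤ 2 * ΣOver (G ─ A) (marg f A)
  K≤2ΣOver-good {m} ∣I─A∣≤K K≤Σ = m≤n+o∧2o≤m⇒m≤2n {o = ∣ B ∣ * gap} (≤-trans K≤Σ split) bad-share
    where
    g : Fin n → ℕ
    g = marg f A
    B : Subset n
    B = Initial m ─ A ─ G
    B-small : ∀ j → to j ∈ B → HasQuotientOfSize≤ isPolymatroid σ θ j
    B-small j e∈B with good-or-small ∣I─A∣≤K j (p─q⊆p _ G e∈B)
    ... | inj₁ e∈G  = contradiction e∈G (x∈p─q⇒x∉q _ G e∈B)
    ... | inj₂ small = small
    I─A⊆G─A∪B : Initial m ─ A ⊆ (G ─ A) ∪ B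
    I─A⊆G─A∪B {x} x∈ with x ∈? G
    ... | yes x∈G = p⊆p∪q B (x∈p∧x∉q⇒x∈p─q x∈G (x∈p─q⇒x∉q _ A x∈))
    ... | no  x∉G = q⊆p∪q _ B (x∈p∧x∉q⇒x∈p─q x∈ x∉G)
    split : ΣOver (Initial m ─ A) g ≤ ΣOver (G ─ A) g + ∣ B ∣ * gap
    split = begin
      ΣOver (Initial m ─ A) g          ≤⟨ ΣOver-mono-⊆ g I─A⊆G─A∪B ⟩
      ΣOver ((G ─ A) ∪ B) g            ≤⟨ ΣOver-∪ g (G ─ A) B ⟩
      ΣOver (G ─ A) g + ΣOver B g      ≤⟨ +-monoʳ-≤ (ΣOver (G ─ A) g) (ΣOver-≤ g B (λ _ → marg≤gap A _)) ⟩
      ΣOver (G ─ A) g + ∣ B ∣ * gap    ∎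
    bad-share : 2 * (∣ B ∣ * gap) ≤ K
    bad-share = begin
      2 * (∣ B ∣ * gap)        ≤⟨ *-monoʳ-≤ 2 (*-monoˡ-≤ gap (∣B∣≤θr isPolymatroid σ θ B-small)) ⟩
      2 * (θ * f ⊤ * gap)      ≡⟨ reassociate θ (f ⊤) gap ⟩
      2 * f ⊤ * θ * gap        ≤⟨ *-monoˡ-≤ gap 2rθ≤k ⟩
      k * gap                  ∎
      where
      reassociate : ∀ a b c → 2 * (a * b * c) ≡ 2 * b * a * c
      reassociate = solve-∀

  K≤2ΣmargOver-good : K ≤ 2 * ΣmargOver f (G ─ A) A
  K≤2ΣmargOver-good =
    let _ , ∣I─A∣≤K , K≤Σ = short-prefix-with-large-marginals
    in  subst (λ S → K ≤ 2 * S) (sym (Σall-if≡ΣOver (G ─ A) (marg f A))) (K≤2ΣOver-good ∣I─A∣≤K K≤Σ)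

lemma3p4 : (n : ℕ) (f : SetFn n) → IsPolymatroid f
    → (∀ e → 0 < f ⁅ e ⁆)
    → (r : ℕ) → f ⊤ ≡ r → 2 ≤ r
    → (k : ℕ) → IsKStar f k → LogSqBound k r
    → (σ : Fin n ↔ Fin n)
    → (G : Subset n) → (∀ j → (Inverse.to σ j ∈ G → IsGood f σ r k j) × (IsGood f σ r k j → Inverse.to σ j ∈ G))
    → (A : Subset n) → IsClosed f A
    → k * (f ⊤ ∸ f A) ≤ 2 * ΣmargOver f (G ─ A) A
lemma3p4 _ _ _             _ _ refl _ zero    _             _ _ _ _      _ _      = z≤n
lemma3p4 _ f isPolymatroid _ _ refl _ (suc k) (_ , k≤kval) _ σ G G-good A closed with f A <? f ⊤
... | yes A<⊤ = K≤2ΣmargOver-good isPolymatroid σ (s≤s z≤n) k≤kval (λ j → proj₂ (G-good j)) closed A<⊤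
... | no  A≮⊤ = subst (_≤ 2 * ΣmargOver f (G ─ A) A)
                      (sym (trans (cong (suc k *_) (m≤n⇒m∸n≡0 (≮⇒≥ A≮⊤))) (*-zeroʳ (suc k)))) z≤n
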